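{- $\mathsf{Clo}$ is sound: if a sequent $\Gamma$ has a $\mathsf{Clo}$ proof, then $\bigvee\Gamma$ is valid.
   Context: Modal $\mu$-calculus formulas are generated by $\phi ::= p \mid \bar p \mid x \mid \phi\lor\phi \mid \phi\land\phi \mid \Diamond\phi \mid \Box\phi \mid \mu x.\phi \mid \nu x.\phi$, with $p$ a propositional variable, $\bar p$ its negation, $x$ a formal variable; validity means truth at every state of every Kripke model. A formula is closed if all formal variables are bound. A sequent is a finite set of closed, clean formulas (each formal variable $x$ bound by a unique subformula $\eta x.\phi$). Subsumption order: $x\le y$ iff $x$ occurs free in $\eta y.\psi$. $\phi[\eta x.\phi]$ is the unfolding. $\Diamond\Gamma=\{\Diamond\phi:\phi\in\Gamma\}$. The system $\mathsf{Clo}$: for each formal variable $x$ fix an infinite set $N_x$ of names, pairwise disjoint; $N=\bigcup_x N_x$. For $\mathfrak y\in N_y$, $\mathfrak y\le x$ iff $y\le x$; for $a\in N^*$, $a\le x$ iff all names in $a$ are $\le x$. $\sqsubseteq$ is the reflexive sub-word relation on $N^*$. Annotated formulas $\phi^a$ ($\phi$ closed, $a\in N^*$); annotated sequents are sets of these. Rules (premises above conclusion): Ax: $p^\epsilon,\bar p^\epsilon$; $\lor$: $\Gamma,\phi^a,\psi^a$ / $\Gamma,(\phi\lor\psi)^a$; $\land$: $\Gamma,\phi^a$ and $\Gamma,\psi^a$ / $\Gamma,(\phi\land\psi)^a$; weakening: $\Gamma$ / $\Gamma,\phi^a$; $\Box$: $\Gamma,\phi^a$ / $\Diamond\Gamma,\Box\phi^a$;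 $\eta$: $\Gamma,\phi[\eta x.\phi]^a$ / $\Gamma,\eta x.\phi^a$ if $a\le x$; Exp: $\phi_1^{a_1},\dots,\phi_n^{a_n}$ / $\phi_1^{b_1},\dots,\phi_n^{b_n}$ if $a_i\sqsubseteq b_i$; $\mathsf{Clo}_{\mathfrak x}$: $\Gamma,\phi[\nu x.\phi]^{a\mathfrak x}$ / $\Gamma,\nu x.\phi^a$, where $a\le\mathfrak x$ and $\mathfrak x$ does not occur in $\Gamma$, and above which leaves labelled $\Gamma,\nu x.\phi^{a\mathfrak x}$ may be marked $\mathfrak x$ (discharged assumptions, companion = this rule instance). A $\mathsf{Clo}$ derivation is a tree of rule instances whose leaves are Ax or discharged assumptions with companion an ancestor, each $\mathsf{Clo}$ instance carrying a unique token in $N_x$ when its principal formula is $\nu x.\phi$. A $\mathsf{Clo}$ proof of $\Gamma$ is a finite $\mathsf{Clo}$ derivation with root $\Gamma$. -}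

module Defs where

open import Level using (Level; Lift; 0ℓ) renaming (suc to lsuc)
open import Data.Nat using (ℕ; _≟_)
open import Data.Bool using (if_then_else_)
open import Data.Product using (Σ; ∃; _×_; _,_; proj₁; proj₂)
open import Data.Sum using (_⊎_)
open import Data.Empty using (⊥)
open import Data.List using (List; []; _∷_; _++_; [_]; map)
open import Data.List.Membership.Propositional using (_∈_)
open import Data.List.Relation.Unary.All using (All)
open import Data.List.Relation.Unary.Any using (Any)
open import Data.List.Relation.Binary.Pointwise using (Pointwise)
open import Data.List.Relation.Binary.Sublist.Propositional using (_⊆_)
open import Data.List.Relation.Unary.Unique.Propositional using (Unique)
open import Relation.Nullary using (¬_; does)
open import Relation.Binary.PropositionalEquality using (_≡_)

-- Syntax of the modal μ-calculus (negation normal form).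
-- Propositional variables and formal (fixpoint) variables are named by ℕ.

data Formula : Set where
  pv  : ℕ → Formula
  nv  : ℕ → Formula
  var : ℕ → Formula
  _∨ᶠ_ : Formula → Formula → Formula
  _∧ᶠ_ : Formula → Formula → Formula
  ◇ᶠ  : Formula → Formula
  □ᶠ  : Formula → Formula
  μᶠ  : ℕ → Formula → Formula
  νᶠ  : ℕ → Formula → Formula

data FreeIn (x : ℕ) : Formula → Set where
  fvar : FreeIn x (var x)
  f∨l  : ∀ {φ ψ} → FreeIn x φ → FreeIn x (φ ∨ᶠ ψ)
  f∨r  : ∀ {φ ψ} → FreeIn x ψ → FreeIn x (φ ∨ᶠ ψ)
  f∧l  : ∀ {φ ψ} → FreeIn x φ → FreeIn x (φ ∧ᶠ ψ)
  f∧r  : ∀ {φ ψ} → FreeIn x ψ → FreeIn x (φ ∧ᶠ ψ)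
  f◇   : ∀ {φ} → FreeIn x φ → FreeIn x (◇ᶠ φ)
  f□   : ∀ {φ} → FreeIn x φ → FreeIn x (□ᶠ φ)
  fμ   : ∀ {y φ} → ¬ (x ≡ y) → FreeIn x φ → FreeIn x (μᶠ y φ)
  fν   : ∀ {y φ} → ¬ (x ≡ y) → FreeIn x φ → FreeIn x (νᶠ y φ)

Closed : Formula → Set
Closed φ = ∀ x → ¬ FreeIn x φ

-- substitution of ψ for the free occurrences of x in φ
-- (only used with closed ψ, so no capture can occur)
sub : Formula → ℕ → Formula → Formula
sub (pv p)    x ψ = pv p
sub (nv p)    x ψ = nv p
sub (var y)   x ψ = if does (y ≟ x) then ψ else var y
sub (φ ∨ᶠ φ') x ψ = sub φ x ψ ∨ᶠ sub φ' x ψ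
sub (φ ∧ᶠ φ') x ψ = sub φ x ψ ∧ᶠ sub φ' x ψ
sub (◇ᶠ φ)    x ψ = ◇ᶠ (sub φ x ψ)
sub (□ᶠ φ)    x ψ = □ᶠ (sub φ x ψ)
sub (μᶠ y φ)  x ψ = if does (y ≟ x) then μᶠ y φ else μᶠ y (sub φ x ψ)
sub (νᶠ y φ)  x ψ = if does (y ≟ x) then νᶠ y φ else νᶠ y (sub φ x ψ)

unfoldμ : ℕ → Formula → Formula
unfoldμ x φ = sub φ x (μᶠ x φ)

unfoldν : ℕ → Formula → Formula
unfoldν x φ = sub φ x (νᶠ x φ)

data _≼_ (χ : Formula) : Formula → Set where
  here : χ ≼ χ
  s∨l  : ∀ {φ ψ} → χ ≼ φ → χ ≼ (φ ∨ᶠ ψ)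
  s∨r  : ∀ {φ ψ} → χ ≼ ψ → χ ≼ (φ ∨ᶠ ψ)
  s∧l  : ∀ {φ ψ} → χ ≼ φ → χ ≼ (φ ∧ᶠ ψ)
  s∧r  : ∀ {φ ψ} → χ ≼ ψ → χ ≼ (φ ∧ᶠ ψ)
  s◇   : ∀ {φ} → χ ≼ φ → χ ≼ (◇ᶠ φ)
  s□   : ∀ {φ} → χ ≼ φ → χ ≼ (□ᶠ φ)
  sμ   : ∀ {y φ} → χ ≼ φ → χ ≼ (μᶠ y φ)
  sν   : ∀ {y φ} → χ ≼ φ → χ ≼ (νᶠ y φ)

data IsBinder (x : ℕ) : Formula → Set where
  isμ : ∀ ψ → IsBinder x (μᶠ x ψ)
  isν : ∀ ψ → IsBinder x (νᶠ x ψ)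

-- A sequent (list read as a finite set) is clean: every formal variable x
-- is bound by a unique subformula η x . φ (across the whole sequent).
Clean : List Formula → Set
Clean Γ = ∀ {φ₁ φ₂ χ₁ χ₂ x} → φ₁ ∈ Γ → φ₂ ∈ Γ → χ₁ ≼ φ₁ → χ₂ ≼ φ₂ →
          IsBinder x χ₁ → IsBinder x χ₂ → χ₁ ≡ χ₂

-- Subsumption order determined by the (clean) root sequent Γ:
-- x ≤ y  iff  x occurs free in the binder  η y . ψ  of y.
VarLe : List Formula → ℕ → ℕ → Set
VarLe Γ x y = Σ Formula λ χ → (Any (λ φ → χ ≼ φ) Γ) × IsBinder y χ × FreeIn x χ

record Kripke : Set₁ where
  field
    S : Set
    R : S → S → Set
    V : ℕ → S → Set

open Kripke public

Env : Kripke → Set₁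
Env M = ℕ → S M → Set

_[_↦_] : ∀ {M} → Env M → ℕ → (S M → Set) → Env M
_[_↦_] ρ x P y = if does (y ≟ x) then P else ρ y

L : Set → Set₁
L A = Lift (lsuc 0ℓ) A

-- μ is the intersection of all prefixed points, ν the union of all
-- postfixed points (Knaster–Tarski).
⟦_⟧ : Formula → (M : Kripke) → Env M → S M → Set₁
⟦ pv p    ⟧ M ρ s = L (V M p s)
⟦ nv p    ⟧ M ρ s = L (¬ V M p s)
⟦ var x   ⟧ M ρ s = L (ρ x s)
⟦ φ ∨ᶠ ψ  ⟧ M ρ s = ⟦ φ ⟧ M ρ s ⊎ ⟦ ψ ⟧ M ρ s
⟦ φ ∧ᶠ ψ  ⟧ M ρ s = ⟦ φ ⟧ M ρ s × ⟦ ψ ⟧ M ρ s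
⟦ ◇ᶠ φ    ⟧ M ρ s = Σ (S M) λ t → L (R M s t) × ⟦ φ ⟧ M ρ t
⟦ □ᶠ φ    ⟧ M ρ s = ∀ t → R M s t → ⟦ φ ⟧ M ρ t
⟦ μᶠ x φ  ⟧ M ρ s = (P : S M → Set) → (∀ t → ⟦ φ ⟧ M (_[_↦_] {M} ρ x P) t → P t) → P s
⟦ νᶠ x φ  ⟧ M ρ s = Σ (S M → Set) λ P → (∀ t → P t → ⟦ φ ⟧ M (_[_↦_] {M} ρ x P) t) × P s

emptyEnv : (M : Kripke) → Env M
emptyEnv M x s = ⊥

Valid : List Formula → Set₁
Valid Γ = ∀ (M : Kripke) (s : S M) → Any (λ φ → ⟦ φ ⟧ M (emptyEnv M) s) Γ

-- names: N_x = { (x , k) | k ∈ ℕ }, pairwise disjoint and infinite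
Name : Set
Name = ℕ × ℕ

Annot : Set
Annot = List Name

AFormula : Set
AFormula = Formula × Annot

ASeq : Set
ASeq = List AFormula

_≋_ : ASeq → ASeq → Set
Δ ≋ Δ' = ∀ z → (z ∈ Δ → z ∈ Δ') × (z ∈ Δ' → z ∈ Δ)

◇ₛ : ASeq → ASeq
◇ₛ = map (λ { (φ , a) → (◇ᶠ φ , a) })

Occurs : Name → ASeq → Set
Occurs 𝔵 Γ = Any (λ fa → 𝔵 ∈ proj₂ fa) Γ

module Clo (_≤v_ : ℕ → ℕ → Set) where

  _≤ₐ_ : Annot → ℕ → Set
  a ≤ₐ x = All (λ n → proj₁ n ≤v x) a

  ExpRel : AFormula → AFormula → Set
  ExpRel (φ , a) (ψ , b) = (φ ≡ ψ) × (a ⊆ b)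

  -- Derivations; A lists the Clo instances below the current node
  -- (token, label Γ, νx.φ^{a𝔵} of dischargeable leaves).
  data Deriv (A : List (Name × ASeq)) : ASeq → Set where
    ax   : ∀ p {Δ} → Δ ≋ ((pv p , []) ∷ (nv p , []) ∷ []) → Deriv A Δ
    orR  : ∀ Γ φ ψ a {Δ} → Deriv A ((φ , a) ∷ (ψ , a) ∷ Γ) →
           Δ ≋ ((φ ∨ᶠ ψ , a) ∷ Γ) → Deriv A Δ
    andR : ∀ Γ φ ψ a {Δ} → Deriv A ((φ , a) ∷ Γ) → Deriv A ((ψ , a) ∷ Γ) →
           Δ ≋ ((φ ∧ᶠ ψ , a) ∷ Γ) → Deriv A Δ
    wk   : ∀ Γ φa {Δ} → Deriv A Γ → Δ ≋ (φa ∷ Γ) → Deriv A Δ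
    boxR : ∀ Γ φ a {Δ} → Deriv A ((φ , a) ∷ Γ) →
           Δ ≋ ((□ᶠ φ , a) ∷ ◇ₛ Γ) → Deriv A Δ
    muR  : ∀ Γ x φ a {Δ} → a ≤ₐ x → Deriv A ((unfoldμ x φ , a) ∷ Γ) →
           Δ ≋ ((μᶠ x φ , a) ∷ Γ) → Deriv A Δ
    nuR  : ∀ Γ x φ a {Δ} → a ≤ₐ x → Deriv A ((unfoldν x φ , a) ∷ Γ) →
           Δ ≋ ((νᶠ x φ , a) ∷ Γ) → Deriv A Δ
    exp  : ∀ Γ Γ' {Δ} → Pointwise ExpRel Γ Γ' → Deriv A Γ → Δ ≋ Γ' → Deriv A Δ
    clo  : ∀ Γ x φ a k {Δ} → a ≤ₐ x → ¬ Occurs (x , k) Γ →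
           Deriv (((x , k) , ((νᶠ x φ , a ++ [ (x , k) ]) ∷ Γ)) ∷ A)
                 ((unfoldν x φ , a ++ [ (x , k) ]) ∷ Γ) →
           Δ ≋ ((νᶠ x φ , a) ∷ Γ) → Deriv A Δ
    assm : ∀ 𝔵 Λ {Δ} → (𝔵 , Λ) ∈ A → Δ ≋ Λ → Deriv A Δ

  tokens : ∀ {A Δ} → Deriv A Δ → List Name
  tokens (ax p _)                 = []
  tokens (orR _ _ _ _ d _)        = tokens d
  tokens (andR _ _ _ _ d e _)     = tokens d ++ tokens e
  tokens (wk _ _ d _)             = tokens d
  tokens (boxR _ _ _ d _)         = tokens d
  tokens (muR _ _ _ _ _ d _)      = tokens d
  tokens (nuR _ _ _ _ _ d _)      = tokens d
  tokens (exp _ _ _ d _)          = tokens d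
  tokens (clo _ x _ _ k _ _ d _)  = (x , k) ∷ tokens d
  tokens (assm _ _ _ _)           = []

CloProof : List Formula → Set
CloProof Γ = Σ (Deriv [] (map (λ φ → (φ , [])) Γ)) (λ d → Unique (tokens d))
  where open Clo (VarLe Γ)

-- Soundness is proved by induction on the finite derivation, for a semantics ⟦ φ ⟧⟨ G ⟩ in which a
-- formula νx.φ may also hold by fiat at the states of a guard G. An annotated formula φ^a is read with
-- the guards contributed by the names in a. The token 𝔵 of a Clo instance concluding νx.φ^a, Γ
-- guards νx.φ exactly on the set U of states at which Γ fails, which makes the discharged leaves
-- νx.φ^{a𝔵}, Γ true. The induction hypothesis then gives the unfolding of νx.φ on U under this guard;
-- as the guard concerns νx.φ itself and not its body, U together with the unguarded extension of νx.φ
-- is a postfixed point, so νx.φ holds on U after all. The side condition a ≤ x, with the subsumption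
-- order made strict by cleanliness, ensures that the guards of the names in a never fire on νx.φ nor
-- on the ν-subformulas instantiated by unfolding, which keeps the μ- and ν-rules sound. At the root
-- all annotations are empty and the guarded semantics is the standard one.

module Submission where

open import Defs
open import Level using (0ℓ; lift) renaming (suc to lsuc)
open import Axiom.ExcludedMiddle using (ExcludedMiddle)
open import Function using (_∘_)
open import Data.Nat using (ℕ; suc; _+_; _≤_; _<_; _≟_; s≤s)
open import Data.Nat.Properties using (≤-refl; ≤-trans; <-irrefl; <-asym; m≤m+n; m≤n+m; n≤1+n)
open import Data.Bool using (true; false; T)
open import Data.Unit using (tt)
open import Data.Empty using (⊥; ⊥-elim)
open import Data.Product using (Σ; _×_; _,_; proj₁; proj₂)
open import Data.Sum using (_⊎_; inj₁; inj₂)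
open import Data.List using (List; []; _∷_; _++_; [_]; map)
open import Data.List.Membership.Propositional using (_∈_; _∉_; find; lose)
open import Data.List.Membership.Propositional.Properties using (∈-++⁻; ∈-++⁺ˡ; ∈-++⁺ʳ; ∈-map⁺; ∈-map⁻)
open import Data.List.Relation.Unary.All using (All; _∷_) renaming (lookup to All-lookup)
import Data.List.Relation.Unary.All.Properties as All
open import Data.List.Relation.Unary.Any using (Any; here; there)
import Data.List.Relation.Unary.Any as Any
import Data.List.Relation.Unary.Any.Properties as Any
open import Data.List.Relation.Unary.AllPairs using ([]; _∷_)
open import Data.List.Relation.Unary.Unique.Propositional using (Unique)
open import Data.List.Relation.Binary.Pointwise using (Pointwise; _∷_; Any-resp-Pointwise)
open import Data.List.Relation.Binary.Sublist.Propositional.Properties using (Any-resp-⊆)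
open import Relation.Nullary using (¬_; yes; no; does; proof)
open import Relation.Nullary.Reflects using (ofʸ; ofⁿ)
open import Relation.Binary.PropositionalEquality using (_≡_; _≢_; refl; sym; cong; cong₂; subst; ≢-sym)

size : Formula → ℕ
size (pv _)   = 1
size (nv _)   = 1
size (var _)  = 1
size (φ ∨ᶠ ψ) = suc (size φ + size ψ)
size (φ ∧ᶠ ψ) = suc (size φ + size ψ)
size (◇ᶠ φ)   = suc (size φ)
size (□ᶠ φ)   = suc (size φ)
size (μᶠ _ φ) = suc (size φ)
size (νᶠ _ φ) = suc (size φ)

≼⇒size≤ : ∀ {χ φ} → χ ≼ φ → size χ ≤ size φ
≼⇒size≤ here = ≤-refl
≼⇒size≤ {φ = φ ∨ᶠ ψ} (s∨l p) = ≤-trans (≼⇒size≤ p) (≤-trans (m≤m+n (size φ) (size ψ)) (n≤1+n _))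
≼⇒size≤ {φ = φ ∨ᶠ ψ} (s∨r p) = ≤-trans (≼⇒size≤ p) (≤-trans (m≤n+m (size ψ) (size φ)) (n≤1+n _))
≼⇒size≤ {φ = φ ∧ᶠ ψ} (s∧l p) = ≤-trans (≼⇒size≤ p) (≤-trans (m≤m+n (size φ) (size ψ)) (n≤1+n _))
≼⇒size≤ {φ = φ ∧ᶠ ψ} (s∧r p) = ≤-trans (≼⇒size≤ p) (≤-trans (m≤n+m (size ψ) (size φ)) (n≤1+n _))
≼⇒size≤ (s◇ p) = ≤-trans (≼⇒size≤ p) (n≤1+n _)
≼⇒size≤ (s□ p) = ≤-trans (≼⇒size≤ p) (n≤1+n _)
≼⇒size≤ (sμ p) = ≤-trans (≼⇒size≤ p) (n≤1+n _)
≼⇒size≤ (sν p) = ≤-trans (≼⇒size≤ p) (n≤1+n _)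

≼-trans : ∀ {χ ψ φ} → χ ≼ ψ → ψ ≼ φ → χ ≼ φ
≼-trans p here    = p
≼-trans p (s∨l q) = s∨l (≼-trans p q)
≼-trans p (s∨r q) = s∨r (≼-trans p q)
≼-trans p (s∧l q) = s∧l (≼-trans p q)
≼-trans p (s∧r q) = s∧r (≼-trans p q)
≼-trans p (s◇ q)  = s◇ (≼-trans p q)
≼-trans p (s□ q)  = s□ (≼-trans p q)
≼-trans p (sμ q)  = sμ (≼-trans p q)
≼-trans p (sν q)  = sν (≼-trans p q)

ν-⋠-body : ∀ {ζ x φ} → ζ ≼ φ → ζ ≢ νᶠ x φ
ν-⋠-body p refl = <-irrefl refl (≼⇒size≤ p)

FreeIn-μ⇒≢ : ∀ {z y φ} → FreeIn z (μᶠ y φ) → z ≢ y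
FreeIn-μ⇒≢ (fμ z≢y _) = z≢y

FreeIn-ν⇒≢ : ∀ {z y φ} → FreeIn z (νᶠ y φ) → z ≢ y
FreeIn-ν⇒≢ (fν z≢y _) = z≢y

FreeIn-sub : ∀ {ψ z x} φ → Closed ψ → FreeIn z (sub φ x ψ) → FreeIn z φ × z ≢ x
FreeIn-sub {z = z} {x} (var y) cl fr with does (y ≟ x) | proof (y ≟ x)
... | true  | _        = ⊥-elim (cl z fr)
... | false | ofⁿ y≢x with fr
...   | fvar = fvar , y≢x
FreeIn-sub (φ ∨ᶠ ψ) cl (f∨l fr) = let f , z≢x = FreeIn-sub φ cl fr in f∨l f , z≢x
FreeIn-sub (φ ∨ᶠ ψ) cl (f∨r fr) = let f , z≢x = FreeIn-sub ψ cl fr in f∨r f , z≢x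
FreeIn-sub (φ ∧ᶠ ψ) cl (f∧l fr) = let f , z≢x = FreeIn-sub φ cl fr in f∧l f , z≢x
FreeIn-sub (φ ∧ᶠ ψ) cl (f∧r fr) = let f , z≢x = FreeIn-sub ψ cl fr in f∧r f , z≢x
FreeIn-sub (◇ᶠ φ) cl (f◇ fr) = let f , z≢x = FreeIn-sub φ cl fr in f◇ f , z≢x
FreeIn-sub (□ᶠ φ) cl (f□ fr) = let f , z≢x = FreeIn-sub φ cl fr in f□ f , z≢x
FreeIn-sub {x = x} (μᶠ y φ) cl fr with does (y ≟ x) | proof (y ≟ x) | fr
... | true  | ofʸ refl | fμ z≢y f = fμ z≢y f , z≢y
... | false | _        | fμ z≢y f = let f′ , z≢x = FreeIn-sub φ cl f in fμ z≢y f′ , z≢x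
FreeIn-sub {x = x} (νᶠ y φ) cl fr with does (y ≟ x) | proof (y ≟ x) | fr
... | true  | ofʸ refl | fν z≢y f = fν z≢y f , z≢y
... | false | _        | fν z≢y f = let f′ , z≢x = FreeIn-sub φ cl f in fν z≢y f′ , z≢x

sub-fresh : ∀ {x ψ} φ → ¬ FreeIn x φ → sub φ x ψ ≡ φ
sub-fresh (pv p) nf = refl
sub-fresh (nv p) nf = refl
sub-fresh {x} (var y) nf with does (y ≟ x) | proof (y ≟ x)
... | true  | ofʸ refl = ⊥-elim (nf fvar)
... | false | _        = refl
sub-fresh (φ ∨ᶠ ψ) nf = cong₂ _∨ᶠ_ (sub-fresh φ (λ f → nf (f∨l f))) (sub-fresh ψ (λ f → nf (f∨r f)))
sub-fresh (φ ∧ᶠ ψ) nf = cong₂ _∧ᶠ_ (sub-fresh φ (λ f → nf (f∧l f))) (sub-fresh ψ (λ f → nf (f∧r f)))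
sub-fresh (◇ᶠ φ) nf = cong ◇ᶠ (sub-fresh φ (λ f → nf (f◇ f)))
sub-fresh (□ᶠ φ) nf = cong □ᶠ (sub-fresh φ (λ f → nf (f□ f)))
sub-fresh {x} (μᶠ y φ) nf with does (y ≟ x) | proof (y ≟ x)
... | true  | _        = refl
... | false | ofⁿ y≢x = cong (μᶠ y) (sub-fresh φ (λ f → nf (fμ (≢-sym y≢x) f)))
sub-fresh {x} (νᶠ y φ) nf with does (y ≟ x) | proof (y ≟ x)
... | true  | _        = refl
... | false | ofⁿ y≢x = cong (νᶠ y) (sub-fresh φ (λ f → nf (fν (≢-sym y≢x) f)))

unfoldμ-closed : ∀ {x φ} → Closed (μᶠ x φ) → Closed (unfoldμ x φ)
unfoldμ-closed {φ = φ} cl z fr = let f , z≢x = FreeIn-sub φ cl fr in cl z (fμ z≢x f)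

unfoldν-closed : ∀ {x φ} → Closed (νᶠ x φ) → Closed (unfoldν x φ)
unfoldν-closed {φ = φ} cl z fr = let f , z≢x = FreeIn-sub φ cl fr in cl z (fν z≢x f)

BinderOrdered : (ℕ → ℕ → Set) → Formula → Set
BinderOrdered _≤v_ φ = ∀ {ζ y z} → ζ ≼ φ → IsBinder y ζ → FreeIn z ζ → z ≤v y

BinderOrdered-sub : ∀ {R ψ x} φ → Closed ψ → BinderOrdered R ψ → BinderOrdered R φ →
                    BinderOrdered R (sub φ x ψ)
BinderOrdered-sub (pv _) cl oψ oφ here () fr
BinderOrdered-sub (nv _) cl oψ oφ here () fr
BinderOrdered-sub {x = x} (var y) cl oψ oφ p b fr with does (y ≟ x)
... | true  = oψ p b fr
... | false with p | b
...   | here | ()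
BinderOrdered-sub (_ ∨ᶠ _) cl oψ oφ here () fr
BinderOrdered-sub (φ ∨ᶠ ψ) cl oψ oφ (s∨l p) b fr = BinderOrdered-sub φ cl oψ (oφ ∘ s∨l) p b fr
BinderOrdered-sub (φ ∨ᶠ ψ) cl oψ oφ (s∨r p) b fr = BinderOrdered-sub ψ cl oψ (oφ ∘ s∨r) p b fr
BinderOrdered-sub (_ ∧ᶠ _) cl oψ oφ here () fr
BinderOrdered-sub (φ ∧ᶠ ψ) cl oψ oφ (s∧l p) b fr = BinderOrdered-sub φ cl oψ (oφ ∘ s∧l) p b fr
BinderOrdered-sub (φ ∧ᶠ ψ) cl oψ oφ (s∧r p) b fr = BinderOrdered-sub ψ cl oψ (oφ ∘ s∧r) p b fr
BinderOrdered-sub (◇ᶠ _) cl oψ oφ here () fr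
BinderOrdered-sub (◇ᶠ φ) cl oψ oφ (s◇ p) b fr = BinderOrdered-sub φ cl oψ (oφ ∘ s◇) p b fr
BinderOrdered-sub (□ᶠ _) cl oψ oφ here () fr
BinderOrdered-sub (□ᶠ φ) cl oψ oφ (s□ p) b fr = BinderOrdered-sub φ cl oψ (oφ ∘ s□) p b fr
BinderOrdered-sub {x = x} (μᶠ y φ) cl oψ oφ p b fr with does (y ≟ x)
... | true = oφ p b fr
... | false with p | b | fr
...   | here   | isμ _ | fμ z≢y f = oφ here (isμ φ) (fμ z≢y (proj₁ (FreeIn-sub φ cl f)))
...   | sμ p′  | _     | _        = BinderOrdered-sub φ cl oψ (oφ ∘ sμ) p′ b fr
BinderOrdered-sub {x = x} (νᶠ y φ) cl oψ oφ p b fr with does (y ≟ x)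
... | true = oφ p b fr
... | false with p | b | fr
...   | here   | isν _ | fν z≢y f = oφ here (isν φ) (fν z≢y (proj₁ (FreeIn-sub φ cl f)))
...   | sν p′  | _     | _        = BinderOrdered-sub φ cl oψ (oφ ∘ sν) p′ b fr

enclosing-binder : ∀ {χ γ x} → χ ≼ γ → FreeIn x χ → ¬ FreeIn x γ →
                   Σ Formula λ β → β ≼ γ × IsBinder x β × size χ < size β
enclosing-binder here f nf = ⊥-elim (nf f)
enclosing-binder (s∨l p) f nf = let β , q , rest = enclosing-binder p f (nf ∘ f∨l) in β , s∨l q , rest
enclosing-binder (s∨r p) f nf = let β , q , rest = enclosing-binder p f (nf ∘ f∨r) in β , s∨r q , rest
enclosing-binder (s∧l p) f nf = let β , q , rest = enclosing-binder p f (nf ∘ f∧l) in β , s∧l q , rest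
enclosing-binder (s∧r p) f nf = let β , q , rest = enclosing-binder p f (nf ∘ f∧r) in β , s∧r q , rest
enclosing-binder (s◇ p) f nf = let β , q , rest = enclosing-binder p f (nf ∘ f◇) in β , s◇ q , rest
enclosing-binder (s□ p) f nf = let β , q , rest = enclosing-binder p f (nf ∘ f□) in β , s□ q , rest
enclosing-binder {x = x} (sμ {y} {φ} p) f nf with x ≟ y
... | yes refl = μᶠ x φ , here , isμ φ , s≤s (≼⇒size≤ p)
... | no x≢y   = let β , q , rest = enclosing-binder p f (nf ∘ fμ x≢y) in β , sμ q , rest
enclosing-binder {x = x} (sν {y} {φ} p) f nf with x ≟ y
... | yes refl = νᶠ x φ , here , isν φ , s≤s (≼⇒size≤ p)
... | no x≢y   = let β , q , rest = enclosing-binder p f (nf ∘ fν x≢y) in β , sν q , rest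

VarLe-irrefl : ∀ {Γ x} → ¬ VarLe Γ x x
VarLe-irrefl (_ , _ , isμ _ , fμ x≢x _) = x≢x refl
VarLe-irrefl (_ , _ , isν _ , fν x≢x _) = x≢x refl

module _ {Γ : List Formula} (closed : All Closed Γ) (clean : Clean Γ) where

  VarLe-size< : ∀ {x y β} (x≤y : VarLe Γ x y) → IsBinder x β → Any (β ≼_) Γ →
                size (proj₁ x≤y) < size β
  VarLe-size< (χ , χ∈Γ , _ , fr) bβ β∈Γ with find χ∈Γ | find β∈Γ
  ... | γ , γ∈Γ , χ≼γ | γ′ , γ′∈Γ , β≼γ′ with enclosing-binder χ≼γ fr (All-lookup closed γ∈Γ _)
  ...   | β″ , β″≼γ , bβ″ , lt rewrite clean γ∈Γ γ′∈Γ β″≼γ β≼γ′ bβ″ bβ = lt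

  VarLe-asym : ∀ {x y} → VarLe Γ x y → ¬ VarLe Γ y x
  VarLe-asym x≤y@(_ , χ∈Γ , bχ , _) y≤x@(_ , β∈Γ , bβ , _) =
    <-asym (VarLe-size< x≤y bβ β∈Γ) (VarLe-size< y≤x bχ χ∈Γ)

module Guarded (em : ExcludedMiddle (lsuc 0ℓ)) (M : Kripke) where

  St : Set
  St = S M

  -- Excluded middle gives every proposition of Set₁ an equivalent copy in Set, so that the states
  -- satisfying a formula form a predicate St → Set, as required by the fixpoint clauses.
  ⌊_⌋ : Set₁ → Set
  ⌊ X ⌋ = T (does (em {X}))

  ⌊⌋-intro : ∀ {X} → X → ⌊ X ⌋
  ⌊⌋-intro {X} x with em {X}
  ... | yes _ = tt
  ... | no ¬x = ¬x x

  ⌊⌋-elim : ∀ {X} → ⌊ X ⌋ → X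
  ⌊⌋-elim {X} u with em {X}
  ... | yes x = x

  _[_≔_] : Env M → ℕ → (St → Set) → Env M
  ρ [ x ≔ P ] = _[_↦_] {M} ρ x P

  Guard : Set₁
  Guard = Formula → St → Set

  ⟦_⟧⟨_⟩ : Formula → Guard → Env M → St → Set₁
  ⟦ pv p    ⟧⟨ G ⟩ ρ s = L (V M p s)
  ⟦ nv p    ⟧⟨ G ⟩ ρ s = L (¬ V M p s)
  ⟦ var x   ⟧⟨ G ⟩ ρ s = L (ρ x s)
  ⟦ φ ∨ᶠ ψ  ⟧⟨ G ⟩ ρ s = ⟦ φ ⟧⟨ G ⟩ ρ s ⊎ ⟦ ψ ⟧⟨ G ⟩ ρ s
  ⟦ φ ∧ᶠ ψ  ⟧⟨ G ⟩ ρ s = ⟦ φ ⟧⟨ G ⟩ ρ s × ⟦ ψ ⟧⟨ G ⟩ ρ s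
  ⟦ ◇ᶠ φ    ⟧⟨ G ⟩ ρ s = Σ St λ t → L (R M s t) × ⟦ φ ⟧⟨ G ⟩ ρ t
  ⟦ □ᶠ φ    ⟧⟨ G ⟩ ρ s = ∀ t → R M s t → ⟦ φ ⟧⟨ G ⟩ ρ t
  ⟦ μᶠ x φ  ⟧⟨ G ⟩ ρ s = (P : St → Set) → (∀ t → ⟦ φ ⟧⟨ G ⟩ (ρ [ x ≔ P ]) t → P t) → P s
  ⟦ νᶠ x φ  ⟧⟨ G ⟩ ρ s = (Σ (St → Set) λ P → (∀ t → P t → ⟦ φ ⟧⟨ G ⟩ (ρ [ x ≔ P ]) t) × P s)
                         ⊎ L (G (νᶠ x φ) s)

  Env⊆ : Formula → Env M → Env M → Set
  Env⊆ φ ρ ρ′ = ∀ z → FreeIn z φ → ∀ t → ρ z t → ρ′ z t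

  Guard⊆ : Formula → Guard → Guard → Set
  Guard⊆ φ G G′ = ∀ ζ → ζ ≼ φ → ∀ s → G ζ s → G′ ζ s

  Env⊆-refl : ∀ {φ ρ} → Env⊆ φ ρ ρ
  Env⊆-refl _ _ _ r = r

  Guard⊆-refl : ∀ {φ G} → Guard⊆ φ G G
  Guard⊆-refl _ _ _ g = g

  ≔-miss : ∀ {ρ x P z t} → z ≢ x → ρ z t → (ρ [ x ≔ P ]) z t
  ≔-miss {x = x} {z = z} z≢x r with does (z ≟ x) | proof (z ≟ x)
  ... | true  | ofʸ z≡x = ⊥-elim (z≢x z≡x)
  ... | false | _        = r

  Env⊆-≔ : ∀ {χ ρ ρ′ y P} → (∀ z → FreeIn z χ → z ≢ y → ∀ t → ρ z t → ρ′ z t) →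
           Env⊆ χ (ρ [ y ≔ P ]) (ρ′ [ y ≔ P ])
  Env⊆-≔ {y = y} h z f t r with does (z ≟ y) | proof (z ≟ y)
  ... | true  | _         = r
  ... | false | ofⁿ z≢y = h z f z≢y t r

  ≔-mono : ∀ {φ ρ x} {P Q : St → Set} → (∀ t → P t → Q t) → Env⊆ φ (ρ [ x ≔ P ]) (ρ [ x ≔ Q ])
  ≔-mono {x = x} P⊆Q z _ t r with does (z ≟ x)
  ... | true  = P⊆Q t r
  ... | false = r

  ≔-swap : ∀ {ρ x y P Q} χ → y ≢ x → Env⊆ χ (ρ [ y ≔ P ] [ x ≔ Q ]) (ρ [ x ≔ Q ] [ y ≔ P ])
  ≔-swap {x = x} {y} _ y≢x z _ t r with does (z ≟ x) | proof (z ≟ x) | does (z ≟ y) | proof (z ≟ y)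
  ... | true  | ofʸ refl | true  | ofʸ refl = ⊥-elim (y≢x refl)
  ... | true  | _        | false | _        = r
  ... | false | _        | true  | _        = r
  ... | false | _        | false | _        = r

  ⟦⟧-mono : ∀ φ {G G′ ρ ρ′} → Guard⊆ φ G G′ → Env⊆ φ ρ ρ′ → ∀ s → ⟦ φ ⟧⟨ G ⟩ ρ s → ⟦ φ ⟧⟨ G′ ⟩ ρ′ s
  ⟦⟧-mono (pv p) _ _ s h = h
  ⟦⟧-mono (nv p) _ _ s h = h
  ⟦⟧-mono (var x) _ ρ⊆ s (lift h) = lift (ρ⊆ x fvar s h)
  ⟦⟧-mono (φ ∨ᶠ ψ) G⊆ ρ⊆ s (inj₁ h) = inj₁ (⟦⟧-mono φ (λ ζ → G⊆ ζ ∘ s∨l) (λ z → ρ⊆ z ∘ f∨l) s h)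
  ⟦⟧-mono (φ ∨ᶠ ψ) G⊆ ρ⊆ s (inj₂ h) = inj₂ (⟦⟧-mono ψ (λ ζ → G⊆ ζ ∘ s∨r) (λ z → ρ⊆ z ∘ f∨r) s h)
  ⟦⟧-mono (φ ∧ᶠ ψ) G⊆ ρ⊆ s (h , k) =
    ⟦⟧-mono φ (λ ζ → G⊆ ζ ∘ s∧l) (λ z → ρ⊆ z ∘ f∧l) s h ,
    ⟦⟧-mono ψ (λ ζ → G⊆ ζ ∘ s∧r) (λ z → ρ⊆ z ∘ f∧r) s k
  ⟦⟧-mono (◇ᶠ φ) G⊆ ρ⊆ s (t , r , h) = t , r , ⟦⟧-mono φ (λ ζ → G⊆ ζ ∘ s◇) (λ z → ρ⊆ z ∘ f◇) t h
  ⟦⟧-mono (□ᶠ φ) G⊆ ρ⊆ s h t r = ⟦⟧-mono φ (λ ζ → G⊆ ζ ∘ s□) (λ z → ρ⊆ z ∘ f□) t (h t r)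
  ⟦⟧-mono (μᶠ x φ) G⊆ ρ⊆ s h P preP =
    h P (λ t → preP t ∘ ⟦⟧-mono φ (λ ζ → G⊆ ζ ∘ sμ) (Env⊆-≔ (λ z f z≢x → ρ⊆ z (fμ z≢x f))) t)
  ⟦⟧-mono (νᶠ x φ) G⊆ ρ⊆ s (inj₁ (P , postP , p)) =
    inj₁ (P , (λ t → ⟦⟧-mono φ (λ ζ → G⊆ ζ ∘ sν) (Env⊆-≔ (λ z f z≢x → ρ⊆ z (fν z≢x f))) t ∘ postP t) , p)
  ⟦⟧-mono (νᶠ x φ) G⊆ ρ⊆ s (inj₂ (lift g)) = inj₂ (lift (G⊆ (νᶠ x φ) here s g))

  ⟦⟧-closed : ∀ φ {G} ρ ρ′ → Closed φ → ∀ s → ⟦ φ ⟧⟨ G ⟩ ρ s → ⟦ φ ⟧⟨ G ⟩ ρ′ s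
  ⟦⟧-closed φ ρ ρ′ cl = ⟦⟧-mono φ Guard⊆-refl (λ z f → ⊥-elim (cl z f))

  ⟦⟧-unguarded : ∀ φ {G ρ} → (∀ ζ s → ¬ G ζ s) → ∀ s → ⟦ φ ⟧⟨ G ⟩ ρ s → ⟦ φ ⟧ M ρ s
  ⟦⟧-unguarded (pv p) _ s h = h
  ⟦⟧-unguarded (nv p) _ s h = h
  ⟦⟧-unguarded (var x) _ s h = h
  ⟦⟧-unguarded (φ ∨ᶠ ψ) ¬G s (inj₁ h) = inj₁ (⟦⟧-unguarded φ ¬G s h)
  ⟦⟧-unguarded (φ ∨ᶠ ψ) ¬G s (inj₂ h) = inj₂ (⟦⟧-unguarded ψ ¬G s h)
  ⟦⟧-unguarded (φ ∧ᶠ ψ) ¬G s (h , k) = ⟦⟧-unguarded φ ¬G s h , ⟦⟧-unguarded ψ ¬G s k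
  ⟦⟧-unguarded (◇ᶠ φ) ¬G s (t , r , h) = t , r , ⟦⟧-unguarded φ ¬G t h
  ⟦⟧-unguarded (□ᶠ φ) ¬G s h t r = ⟦⟧-unguarded φ ¬G t (h t r)
  ⟦⟧-unguarded (μᶠ x φ) ¬G s h P preP = h P (λ t → preP t ∘ ⟦⟧-unguarded φ ¬G t)
  ⟦⟧-unguarded (νᶠ x φ) ¬G s (inj₁ (P , postP , p)) = P , (λ t → ⟦⟧-unguarded φ ¬G t ∘ postP t) , p
  ⟦⟧-unguarded (νᶠ x φ) ¬G s (inj₂ (lift g)) = ⊥-elim (¬G _ s g)

  NoGuardOnSub : Guard → Formula → ℕ → Formula → Set
  NoGuardOnSub G φ x ψ = ∀ y χ → νᶠ y χ ≼ φ → FreeIn x (νᶠ y χ) → ∀ s → ¬ G (νᶠ y (sub χ x ψ)) s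

  ⟦⟧-sub⁻ : ∀ φ {G ρ x ψ Q} → NoGuardOnSub G φ x ψ → (∀ ρ′ t → ⟦ ψ ⟧⟨ G ⟩ ρ′ t → Q t) →
            ∀ s → ⟦ sub φ x ψ ⟧⟨ G ⟩ ρ s → ⟦ φ ⟧⟨ G ⟩ (ρ [ x ≔ Q ]) s
  ⟦⟧-sub⁻ (pv p) _ _ s h = h
  ⟦⟧-sub⁻ (nv p) _ _ s h = h
  ⟦⟧-sub⁻ (var y) {ρ = ρ} {x} _ ψ⊆Q s h with does (y ≟ x)
  ... | true  = lift (ψ⊆Q ρ s h)
  ... | false = h
  ⟦⟧-sub⁻ (φ ∨ᶠ ψ) ng ψ⊆Q s (inj₁ h) = inj₁ (⟦⟧-sub⁻ φ (λ y χ → ng y χ ∘ s∨l) ψ⊆Q s h)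
  ⟦⟧-sub⁻ (φ ∨ᶠ ψ) ng ψ⊆Q s (inj₂ h) = inj₂ (⟦⟧-sub⁻ ψ (λ y χ → ng y χ ∘ s∨r) ψ⊆Q s h)
  ⟦⟧-sub⁻ (φ ∧ᶠ ψ) ng ψ⊆Q s (h , k) =
    ⟦⟧-sub⁻ φ (λ y χ → ng y χ ∘ s∧l) ψ⊆Q s h , ⟦⟧-sub⁻ ψ (λ y χ → ng y χ ∘ s∧r) ψ⊆Q s k
  ⟦⟧-sub⁻ (◇ᶠ φ) ng ψ⊆Q s (t , r , h) = t , r , ⟦⟧-sub⁻ φ (λ y χ → ng y χ ∘ s◇) ψ⊆Q t h
  ⟦⟧-sub⁻ (□ᶠ φ) ng ψ⊆Q s h t r = ⟦⟧-sub⁻ φ (λ y χ → ng y χ ∘ s□) ψ⊆Q t (h t r)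
  ⟦⟧-sub⁻ (μᶠ y φ) {ρ = ρ} {x} {Q = Q} ng ψ⊆Q s h with does (y ≟ x) | proof (y ≟ x)
  ... | true  | ofʸ refl =
    ⟦⟧-mono (μᶠ y φ) Guard⊆-refl (λ z f t → ≔-miss {ρ} {x} {Q} (FreeIn-μ⇒≢ f)) s h
  ... | false | ofⁿ y≢x = λ P preP → h P (λ t → preP t ∘ ⟦⟧-mono φ Guard⊆-refl (≔-swap φ y≢x) t
                                               ∘ ⟦⟧-sub⁻ φ (λ y′ χ → ng y′ χ ∘ sμ) ψ⊆Q t)
  ⟦⟧-sub⁻ (νᶠ y φ) {G} {ρ} {x} {Q = Q} ng ψ⊆Q s h with does (y ≟ x) | proof (y ≟ x)
  ... | true  | ofʸ refl =
    ⟦⟧-mono (νᶠ y φ) Guard⊆-refl (λ z f t → ≔-miss {ρ} {x} {Q} (FreeIn-ν⇒≢ f)) s h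
  ... | false | ofⁿ y≢x with h
  ...   | inj₁ (P , postP , p) =
    inj₁ (P , (λ t → ⟦⟧-mono φ Guard⊆-refl (≔-swap φ y≢x) t
                     ∘ ⟦⟧-sub⁻ φ (λ y′ χ → ng y′ χ ∘ sν) ψ⊆Q t ∘ postP t) , p)
  ...   | inj₂ (lift g) with em {L (FreeIn x (νᶠ y φ))}
  ...     | yes (lift x∈φ) = ⊥-elim (ng y φ here x∈φ s g)
  ...     | no x∉φ =
    inj₂ (lift (subst (λ χ → G (νᶠ y χ) s) (sub-fresh φ (λ f → x∉φ (lift (fν (≢-sym y≢x) f)))) g))

  ∥_∥⟨_⟩ : Formula → Guard → Env M → St → Set
  ∥ φ ∥⟨ G ⟩ ρ t = ⌊ ⟦ φ ⟧⟨ G ⟩ ρ t ⌋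

  ⟦⟧-sub-closed⁻ : ∀ φ {G ρ x ψ} → Closed ψ → NoGuardOnSub G φ x ψ →
                   ∀ s → ⟦ sub φ x ψ ⟧⟨ G ⟩ ρ s → ⟦ φ ⟧⟨ G ⟩ (ρ [ x ≔ ∥ ψ ∥⟨ G ⟩ ρ ]) s
  ⟦⟧-sub-closed⁻ φ {ψ = ψ} cl ng = ⟦⟧-sub⁻ φ ng (λ ρ′ t → ⌊⌋-intro ∘ ⟦⟧-closed ψ ρ′ _ cl t)

  unfoldμ-sound : ∀ {G ρ x φ} → Closed (μᶠ x φ) → NoGuardOnSub G φ x (μᶠ x φ) →
                  ∀ s → ⟦ unfoldμ x φ ⟧⟨ G ⟩ ρ s → ⟦ μᶠ x φ ⟧⟨ G ⟩ ρ s
  unfoldμ-sound {φ = φ} cl ng s h P preP =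
    preP s (⟦⟧-mono φ Guard⊆-refl (≔-mono (λ t q → ⌊⌋-elim q P preP)) s
      (⟦⟧-sub-closed⁻ φ cl ng s h))

  ν-postfixed : ∀ {G ρ x φ} (P : St → Set) → (∀ t → ¬ G (νᶠ x φ) t) →
                ∀ t → ∥ νᶠ x φ ∥⟨ G ⟩ ρ t → ⟦ φ ⟧⟨ G ⟩ (ρ [ x ≔ (λ t′ → ∥ νᶠ x φ ∥⟨ G ⟩ ρ t′ ⊎ P t′) ]) t
  ν-postfixed {φ = φ} P ¬G t q with ⌊⌋-elim q
  ... | inj₁ (P′ , postP′ , p′) =
    ⟦⟧-mono φ Guard⊆-refl (≔-mono (λ t′ p → inj₁ (⌊⌋-intro (inj₁ (P′ , postP′ , p))))) t (postP′ t p′)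
  ... | inj₂ (lift g) = ⊥-elim (¬G t g)

  unfoldν-sound : ∀ {G ρ x φ} → Closed (νᶠ x φ) → NoGuardOnSub G φ x (νᶠ x φ) → (∀ t → ¬ G (νᶠ x φ) t) →
                  ∀ s → ⟦ unfoldν x φ ⟧⟨ G ⟩ ρ s → ⟦ νᶠ x φ ⟧⟨ G ⟩ ρ s
  unfoldν-sound {G} {ρ} {x} {φ} cl ng ¬G s h = inj₁ (P , postP , inj₂ refl)
    where
    P : St → Set
    P t = ∥ νᶠ x φ ∥⟨ G ⟩ ρ t ⊎ t ≡ s
    postP : ∀ t → P t → ⟦ φ ⟧⟨ G ⟩ (ρ [ x ≔ P ]) t
    postP t (inj₁ n) = ν-postfixed (_≡ s) ¬G t n
    postP t (inj₂ refl) = ⟦⟧-mono φ Guard⊆-refl (≔-mono (λ t′ → inj₁)) s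
      (⟦⟧-sub-closed⁻ φ cl ng s h)

  ν-coinduction : ∀ {G G′ ρ x φ} (U : St → Set) → Closed (νᶠ x φ) →
                  Guard⊆ φ G′ G → (∀ t → G′ (νᶠ x φ) t → U t) → (∀ t → ¬ G (νᶠ x φ) t) →
                  NoGuardOnSub G′ φ x (νᶠ x φ) → (∀ t → U t → ⟦ unfoldν x φ ⟧⟨ G′ ⟩ ρ t) →
                  ∀ s → U s → ⟦ νᶠ x φ ⟧⟨ G ⟩ ρ s
  ν-coinduction {G} {G′} {ρ} {x} {φ} U cl G′⊆G G′ν⊆U ¬G ng premise s u = inj₁ (P , postP , inj₂ u)
    where
    P : St → Set
    P t = ∥ νᶠ x φ ∥⟨ G ⟩ ρ t ⊎ U t
    ν′⊆P : ∀ t → ∥ νᶠ x φ ∥⟨ G′ ⟩ ρ t → P t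
    ν′⊆P t q with ⌊⌋-elim q
    ... | inj₁ (P′ , postP′ , p′) =
      inj₁ (⌊⌋-intro (inj₁ (P′ , (λ t′ → ⟦⟧-mono φ G′⊆G Env⊆-refl t′ ∘ postP′ t′) , p′)))
    ... | inj₂ (lift g) = inj₂ (G′ν⊆U t g)
    postP : ∀ t → P t → ⟦ φ ⟧⟨ G ⟩ (ρ [ x ≔ P ]) t
    postP t (inj₁ n) = ν-postfixed U ¬G t n
    postP t (inj₂ u) = ⟦⟧-mono φ G′⊆G (≔-mono ν′⊆P) t
      (⟦⟧-sub-closed⁻ φ cl ng t (premise t u))

Any-≋ : ∀ {p} {P : AFormula → Set p} {Δ Λ} → Δ ≋ Λ → Any P Λ → Any P Δ
Any-≋ Δ≋Λ pΛ = let fa , fa∈Λ , pfa = find pΛ in lose (proj₂ (Δ≋Λ fa) fa∈Λ) pfa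

Unique-++⁻ˡ : ∀ {A : Set} (xs : List A) {ys} → Unique (xs ++ ys) → Unique xs
Unique-++⁻ˡ []       _          = []
Unique-++⁻ˡ (x ∷ xs) (x∉ ∷ xs!) = All.++⁻ˡ xs x∉ ∷ Unique-++⁻ˡ xs xs!

Unique-++⁻ʳ : ∀ {A : Set} (xs : List A) {ys} → Unique (xs ++ ys) → Unique ys
Unique-++⁻ʳ []       ys!        = ys!
Unique-++⁻ʳ (x ∷ xs) (_ ∷ xs!) = Unique-++⁻ʳ xs xs!

module Soundness (em : ExcludedMiddle (lsuc 0ℓ)) {Γ₀ : List Formula}
                 (closed₀ : All Closed Γ₀) (clean₀ : Clean Γ₀) (M : Kripke) where

  open Guarded em M
  open Clo (VarLe Γ₀)

  Assignment : Set₁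
  Assignment = Name → Formula → St → Set

  guardOf : Annot → Assignment → Guard
  guardOf a ι ζ s = Σ Name λ n → n ∈ a × ι n ζ s

  True : Assignment → AFormula → St → Set₁
  True ι (φ , a) s = ⟦ φ ⟧⟨ guardOf a ι ⟩ (emptyEnv M) s

  Holds : Assignment → ASeq → Set₁
  Holds ι Δ = ∀ s → Any (λ fa → True ι fa s) Δ

  record Admissible (A : List (Name × ASeq)) (ι : Assignment) : Set₁ where
    field
      guards-own-var : ∀ {n y χ s} → ι n (νᶠ y χ) s → proj₁ n ≡ y
      unassumed-idle : ∀ {n ζ s} → n ∉ map proj₁ A → ¬ ι n ζ s
      assumptions-hold : ∀ {n Λ} → (n , Λ) ∈ A → Holds ι Λ

  Good : Formula → Set
  Good φ = Closed φ × BinderOrdered (VarLe Γ₀) φ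

  AllGood : ASeq → Set
  AllGood Δ = ∀ {fa} → fa ∈ Δ → Good (proj₁ fa)

  AllGood-≋ : ∀ {Δ Λ} → Δ ≋ Λ → AllGood Δ → AllGood Λ
  AllGood-≋ Δ≋Λ good fa∈Λ = good (proj₂ (Δ≋Λ _) fa∈Λ)

  AllGood-∷ : ∀ {fa Δ} → Good (proj₁ fa) → AllGood Δ → AllGood (fa ∷ Δ)
  AllGood-∷ g _  (here refl) = g
  AllGood-∷ _ gs (there m)   = gs m

  Good-≼ : ∀ {φ χ} → Good φ → χ ≼ φ → (∀ {z} → FreeIn z χ → FreeIn z φ) → Good χ
  Good-≼ (cl , ord) χ≼φ fv = (λ z → cl z ∘ fv) , (λ ζ≼χ → ord (≼-trans ζ≼χ χ≼φ))

  Good-unfoldμ : ∀ {x φ} → Good (μᶠ x φ) → Good (unfoldμ x φ)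
  Good-unfoldμ {φ = φ} (cl , ord) = unfoldμ-closed cl , BinderOrdered-sub φ cl ord (ord ∘ sμ)

  Good-unfoldν : ∀ {x φ} → Good (νᶠ x φ) → Good (unfoldν x φ)
  Good-unfoldν {φ = φ} (cl , ord) = unfoldν-closed cl , BinderOrdered-sub φ cl ord (ord ∘ sν)

  guardOf-mono : ∀ {a ι ι′} → (∀ n ζ t → ι n ζ t → ι′ n ζ t) →
                 ∀ φ → Guard⊆ φ (guardOf a ι) (guardOf a ι′)
  guardOf-mono ι⊆ι′ _ ζ _ t (n , n∈a , g) = n , n∈a , ι⊆ι′ n ζ t g

  no-guard-on-sub : ∀ {A ι b x φ ψ} → Admissible A ι →
                    (∀ {n} → n ∈ b → VarLe Γ₀ (proj₁ n) x ⊎ proj₁ n ≡ x) →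
                    BinderOrdered (VarLe Γ₀) φ → NoGuardOnSub (guardOf b ι) φ x ψ
  no-guard-on-sub adm b≤x ord y χ ν≼φ x∈ν s (n , n∈b , g)
    with Admissible.guards-own-var adm g | b≤x n∈b
  ... | refl | inj₁ y≤x = VarLe-asym closed₀ clean₀ y≤x (ord ν≼φ (isν χ) x∈ν)
  ... | refl | inj₂ y≡x = FreeIn-ν⇒≢ x∈ν (sym y≡x)

  no-guard-on-ν : ∀ {A ι a x φ} → Admissible A ι → a ≤ₐ x → ∀ t → ¬ guardOf a ι (νᶠ x φ) t
  no-guard-on-ν adm a≤x t (n , n∈a , g) with Admissible.guards-own-var adm g
  ... | refl = VarLe-irrefl (All-lookup a≤x n∈a)

  Holds-≋ : ∀ {ι Δ Λ} → Δ ≋ Λ → Holds ι Λ → Holds ι Δ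
  Holds-≋ Δ≋Λ h = Any-≋ Δ≋Λ ∘ h

  ax-holds : ∀ {ι} p → Holds ι ((pv p , []) ∷ (nv p , []) ∷ [])
  ax-holds p s with em {L (V M p s)}
  ... | yes v  = here v
  ... | no ¬v = there (here (lift (¬v ∘ lift)))

  ∨-holds : ∀ {ι Γ φ ψ a} → Holds ι ((φ , a) ∷ (ψ , a) ∷ Γ) → Holds ι ((φ ∨ᶠ ψ , a) ∷ Γ)
  ∨-holds h s with h s
  ... | here tφ          = here (inj₁ tφ)
  ... | there (here tψ)  = here (inj₂ tψ)
  ... | there (there tΓ) = there tΓ

  ∧-holds : ∀ {ι Γ φ ψ a} → Holds ι ((φ , a) ∷ Γ) → Holds ι ((ψ , a) ∷ Γ) → Holds ι ((φ ∧ᶠ ψ , a) ∷ Γ)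
  ∧-holds hφ hψ s with hφ s | hψ s
  ... | there tΓ | _        = there tΓ
  ... | _        | there tΓ = there tΓ
  ... | here tφ  | here tψ  = here (tφ , tψ)

  □-holds : ∀ {ι Γ φ a} → Holds ι ((φ , a) ∷ Γ) → Holds ι ((□ᶠ φ , a) ∷ ◇ₛ Γ)
  □-holds {ι} {Γ} {φ} {a} h s with em {Σ St λ t → L (R M s t) × ¬ True ι (φ , a) t}
  ... | yes (t , r , ¬tφ) with h t
  ...   | here tφ = ⊥-elim (¬tφ tφ)
  ...   | there tΓ = there (Any.map⁺ (Any.map (λ tψ → t , r , tψ) tΓ))
  □-holds {ι} {Γ} {φ} {a} h s | no ∄t = here □φ
    where
    □φ : ∀ t → R M s t → True ι (φ , a) t
    □φ t r with em {True ι (φ , a) t}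
    ... | yes tφ  = tφ
    ... | no ¬tφ = ⊥-elim (∄t (t , lift r , ¬tφ))

  μ-holds : ∀ {A ι Γ x φ a} → Admissible A ι → a ≤ₐ x → Good (μᶠ x φ) →
            Holds ι ((unfoldμ x φ , a) ∷ Γ) → Holds ι ((μᶠ x φ , a) ∷ Γ)
  μ-holds adm a≤x (cl , ord) h s with h s
  ... | there tΓ = there tΓ
  ... | here tφ  = here (unfoldμ-sound cl (no-guard-on-sub adm (inj₁ ∘ All-lookup a≤x) (ord ∘ sμ)) s tφ)

  ν-holds : ∀ {A ι Γ x φ a} → Admissible A ι → a ≤ₐ x → Good (νᶠ x φ) →
            Holds ι ((unfoldν x φ , a) ∷ Γ) → Holds ι ((νᶠ x φ , a) ∷ Γ)
  ν-holds adm a≤x (cl , ord) h s with h s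
  ... | there tΓ = there tΓ
  ... | here tφ  = here (unfoldν-sound cl (no-guard-on-sub adm (inj₁ ∘ All-lookup a≤x) (ord ∘ sν))
                                         (no-guard-on-ν adm a≤x) s tφ)

  ExpRel-True : ∀ {ι s fa fb} → ExpRel fa fb → True ι fa s → True ι fb s
  ExpRel-True {fa = φ , _} (refl , a⊆b) =
    ⟦⟧-mono φ (λ _ _ _ (n , n∈a , g) → n , Any-resp-⊆ a⊆b n∈a , g) Env⊆-refl _

  exp-holds : ∀ {ι Γ Γ′} → Pointwise ExpRel Γ Γ′ → Holds ι Γ → Holds ι Γ′
  exp-holds Γ~Γ′ h s = Any-resp-Pointwise ExpRel-True Γ~Γ′ (h s)

  AllGood-exp : ∀ {Γ Γ′} → Pointwise ExpRel Γ Γ′ → AllGood Γ′ → AllGood Γ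
  AllGood-exp ((refl , _) ∷ _)  good (here refl) = good (here refl)
  AllGood-exp (_ ∷ rs)          good (there m)   = AllGood-exp rs (good ∘ there) m

  True-mono : ∀ {ι ι′} → (∀ n ζ t → ι n ζ t → ι′ n ζ t) → ∀ {fa t} → True ι fa t → True ι′ fa t
  True-mono ι⊆ι′ {φ , _} = ⟦⟧-mono φ (guardOf-mono ι⊆ι′ φ) Env⊆-refl _

  Holds-mono : ∀ {ι ι′} → (∀ n ζ t → ι n ζ t → ι′ n ζ t) → ∀ {Δ} → Holds ι Δ → Holds ι′ Δ
  Holds-mono ι⊆ι′ h = Any.map (True-mono ι⊆ι′) ∘ h

  extend : Assignment → Name → Formula → (St → Set) → Assignment
  extend ι 𝔵 ζ₀ U n ζ t = ι n ζ t ⊎ (n ≡ 𝔵 × ζ ≡ ζ₀ × U t)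

  Refutes : Assignment → ASeq → St → Set
  Refutes ι Γ t = ⌊ ¬ Any (λ fa → True ι fa t) Γ ⌋

  True-forget : ∀ {ι 𝔵 ζ₀ U a t} φ → 𝔵 ∉ a → True (extend ι 𝔵 ζ₀ U) (φ , a) t → True ι (φ , a) t
  True-forget φ 𝔵∉a = ⟦⟧-mono φ forget Env⊆-refl _
    where
    forget : Guard⊆ φ _ _
    forget _ _ _ (n , n∈a , inj₁ g)            = n , n∈a , g
    forget _ _ _ (n , n∈a , inj₂ (refl , _)) = ⊥-elim (𝔵∉a n∈a)

  Any-True-forget : ∀ {ι 𝔵 ζ₀ U t} Γ → ¬ Occurs 𝔵 Γ →
                    Any (λ fa → True (extend ι 𝔵 ζ₀ U) fa t) Γ → Any (λ fa → True ι fa t) Γ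
  Any-True-forget ((φ , _) ∷ _) ¬occ (here h)  = here (True-forget φ (¬occ ∘ here) h)
  Any-True-forget (_ ∷ Γ)       ¬occ (there h) = there (Any-True-forget Γ (¬occ ∘ there) h)

  clo-admissible : ∀ {A ι Γ x φ a k} → Admissible A ι → (x , k) ∉ map proj₁ A →
                   Admissible (((x , k) , ((νᶠ x φ , a ++ [ (x , k) ]) ∷ Γ)) ∷ A)
                              (extend ι (x , k) (νᶠ x φ) (Refutes ι Γ))
  clo-admissible {ι = ι} {Γ} {a = a} adm fresh = record
    { guards-own-var   = λ { (inj₁ g) → guards-own-var g
                           ; (inj₂ (refl , refl , _)) → refl }
    ; unassumed-idle   = λ { n∉ (inj₁ g) → unassumed-idle (n∉ ∘ there) g
                           ; n∉ (inj₂ (n≡𝔵 , _)) → n∉ (here n≡𝔵) }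
    ; assumptions-hold = λ { (here refl) → companion
                           ; (there m) → Holds-mono (λ _ _ _ → inj₁) (assumptions-hold m) }
    }
    where
    open Admissible adm
    companion : Holds (extend ι _ _ (Refutes ι Γ)) _
    companion t with em {Any (λ fa → True ι fa t) Γ}
    ... | yes tΓ  = there (Any.map (True-mono (λ _ _ _ → inj₁)) tΓ)
    ... | no ¬tΓ = here (inj₂ (lift (_ , ∈-++⁺ʳ a (here refl) , inj₂ (refl , refl , ⌊⌋-intro ¬tΓ))))

  clo-holds : ∀ {A ι Γ x φ a k} → Admissible A ι → (x , k) ∉ map proj₁ A → a ≤ₐ x →
              ¬ Occurs (x , k) Γ → Good (νᶠ x φ) →
              (∀ {ι′} → Admissible (((x , k) , ((νᶠ x φ , a ++ [ (x , k) ]) ∷ Γ)) ∷ A) ι′ →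
                 Holds ι′ ((unfoldν x φ , a ++ [ (x , k) ]) ∷ Γ)) →
              Holds ι ((νᶠ x φ , a) ∷ Γ)
  clo-holds {A} {ι} {Γ} {x} {φ} {a} {k} adm fresh a≤x ¬occ (cl , ord) premise s
    with em {Any (λ fa → True ι fa s) Γ}
  ... | yes tΓ  = there tΓ
  ... | no ¬tΓ =
    here (ν-coinduction (Refutes ι Γ) cl body-guards ν-guards (no-guard-on-ν adm a≤x)
            (no-guard-on-sub adm′ a𝔵≤x (ord ∘ sν)) premise-on-U s (⌊⌋-intro ¬tΓ))
    where
    𝔵 = (x , k)
    ι′ = extend ι 𝔵 (νᶠ x φ) (Refutes ι Γ)
    adm′ = clo-admissible {φ = φ} {a} adm fresh
    a𝔵≤x : ∀ {n} → n ∈ a ++ [ 𝔵 ] → VarLe Γ₀ (proj₁ n) x ⊎ proj₁ n ≡ x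
    a𝔵≤x n∈ with ∈-++⁻ a n∈
    ... | inj₁ n∈a        = inj₁ (All-lookup a≤x n∈a)
    ... | inj₂ (here refl) = inj₂ refl
    𝔵-idle : ∀ {ζ t} → ¬ ι 𝔵 ζ t
    𝔵-idle = Admissible.unassumed-idle adm fresh
    body-guards : Guard⊆ φ (guardOf (a ++ [ 𝔵 ]) ι′) (guardOf a ι)
    body-guards ζ _ t (n , n∈ , inj₁ g) with ∈-++⁻ a n∈
    ... | inj₁ n∈a        = n , n∈a , g
    ... | inj₂ (here refl) = ⊥-elim (𝔵-idle g)
    body-guards ζ ζ≼φ t (n , n∈ , inj₂ (_ , ζ≡ν , _)) = ⊥-elim (ν-⋠-body ζ≼φ ζ≡ν)
    ν-guards : ∀ t → guardOf (a ++ [ 𝔵 ]) ι′ (νᶠ x φ) t → Refutes ι Γ t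
    ν-guards t (n , n∈ , inj₁ g) with ∈-++⁻ a n∈
    ... | inj₁ n∈a        = ⊥-elim (no-guard-on-ν adm a≤x t (n , n∈a , g))
    ... | inj₂ (here refl) = ⊥-elim (𝔵-idle g)
    ν-guards t (n , n∈ , inj₂ (_ , _ , u)) = u
    premise-on-U : ∀ t → Refutes ι Γ t → ⟦ unfoldν x φ ⟧⟨ guardOf (a ++ [ 𝔵 ]) ι′ ⟩ (emptyEnv M) t
    premise-on-U t u with premise adm′ t
    ... | here h   = h
    ... | there tΓ = ⊥-elim (⌊⌋-elim u (Any-True-forget Γ ¬occ tΓ))

  head-Good : ∀ {Δ fa Γ} → Δ ≋ (fa ∷ Γ) → AllGood Δ → Good (proj₁ fa)
  head-Good Δ≋ good = AllGood-≋ Δ≋ good (here refl)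

  tail-Good : ∀ {Δ fa Γ} → Δ ≋ (fa ∷ Γ) → AllGood Δ → AllGood Γ
  tail-Good Δ≋ good = AllGood-≋ Δ≋ good ∘ there

  sound : ∀ {A Δ ι} (d : Deriv A Δ) → Unique (tokens d) → (∀ {n} → n ∈ tokens d → n ∉ map proj₁ A) →
          Admissible A ι → AllGood Δ → Holds ι Δ
  sound (ax p Δ≋) _ _ _ _ = Holds-≋ Δ≋ (ax-holds p)
  sound (orR Γ φ ψ a d Δ≋) u dj adm good = Holds-≋ Δ≋ (∨-holds (sound d u dj adm
    (AllGood-∷ (Good-≼ (head-Good Δ≋ good) (s∨l here) f∨l)
      (AllGood-∷ (Good-≼ (head-Good Δ≋ good) (s∨r here) f∨r) (tail-Good Δ≋ good)))))
  sound (andR Γ φ ψ a d e Δ≋) u dj adm good = Holds-≋ Δ≋ (∧-holds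
    (sound d (Unique-++⁻ˡ (tokens d) u) (dj ∘ ∈-++⁺ˡ) adm
      (AllGood-∷ (Good-≼ (head-Good Δ≋ good) (s∧l here) f∧l) (tail-Good Δ≋ good)))
    (sound e (Unique-++⁻ʳ (tokens d) u) (dj ∘ ∈-++⁺ʳ (tokens d)) adm
      (AllGood-∷ (Good-≼ (head-Good Δ≋ good) (s∧r here) f∧r) (tail-Good Δ≋ good))))
  sound (wk Γ _ d Δ≋) u dj adm good = Holds-≋ Δ≋ (there ∘ sound d u dj adm (tail-Good Δ≋ good))
  sound (boxR Γ φ a d Δ≋) u dj adm good = Holds-≋ Δ≋ (□-holds (sound d u dj adm
    (AllGood-∷ (Good-≼ (head-Good Δ≋ good) (s□ here) f□)
      (λ m → Good-≼ (tail-Good Δ≋ good (∈-map⁺ _ m)) (s◇ here) f◇))))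
  sound (muR Γ x φ a a≤x d Δ≋) u dj adm good = Holds-≋ Δ≋ (μ-holds adm a≤x (head-Good Δ≋ good)
    (sound d u dj adm (AllGood-∷ (Good-unfoldμ (head-Good Δ≋ good)) (tail-Good Δ≋ good))))
  sound (nuR Γ x φ a a≤x d Δ≋) u dj adm good = Holds-≋ Δ≋ (ν-holds adm a≤x (head-Good Δ≋ good)
    (sound d u dj adm (AllGood-∷ (Good-unfoldν (head-Good Δ≋ good)) (tail-Good Δ≋ good))))
  sound (exp Γ Γ′ Γ~Γ′ d Δ≋) u dj adm good =
    Holds-≋ Δ≋ (exp-holds Γ~Γ′ (sound d u dj adm (AllGood-exp Γ~Γ′ (AllGood-≋ Δ≋ good))))
  sound (assm _ _ m Δ≋) _ _ adm _ = Holds-≋ Δ≋ (Admissible.assumptions-hold adm m)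
  sound (clo Γ x φ a k a≤x ¬occ d Δ≋) (𝔵∉d ∷ u) dj adm good =
    Holds-≋ Δ≋ (clo-holds adm (dj (here refl)) a≤x ¬occ (head-Good Δ≋ good)
      (λ adm′ → sound d u dj′ adm′ (AllGood-∷ (Good-unfoldν (head-Good Δ≋ good)) (tail-Good Δ≋ good))))
    where
    dj′ : ∀ {n} → n ∈ tokens d → n ∉ (x , k) ∷ map proj₁ _
    dj′ n∈d (here refl) = All-lookup 𝔵∉d n∈d refl
    dj′ n∈d (there m)   = dj (there n∈d) m

  ι∅ : Assignment
  ι∅ _ _ _ = ⊥

  Admissible-ι∅ : Admissible [] ι∅
  Admissible-ι∅ = record { guards-own-var = λ () ; unassumed-idle = λ _ () ; assumptions-hold = λ () }

  guardOf-ι∅ : ∀ {a} ζ s → ¬ guardOf a ι∅ ζ s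
  guardOf-ι∅ _ _ (_ , _ , ())

  root-Good : AllGood (map (_, []) Γ₀)
  root-Good m with ∈-map⁻ (_, []) m
  ... | φ , φ∈Γ₀ , refl = All-lookup closed₀ φ∈Γ₀ , λ ζ≼φ b fr → _ , lose φ∈Γ₀ ζ≼φ , b , fr

mainTheorem2 : ExcludedMiddle (lsuc 0ℓ) →
    (Γ : List Formula) → All Closed Γ → Clean Γ → CloProof Γ → Valid Γ
mainTheorem2 em Γ closed clean (d , unique) M s =
  Any.map (⟦⟧-unguarded _ guardOf-ι∅ s) (Any.map⁻ (sound d unique (λ _ ()) Admissible-ι∅ root-Good s))
  where
  open Guarded em M
  open Soundness em closed clean M
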